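{- Let $T$ be a word over a totally ordered alphabet $\Sigma$, and let $\$$ be a symbol not occurring in $T$ with $\$<c$ for every $c\in\Sigma$. Then the Galois factorization of $T$ is $(G_1,G_2,\dots,G_k)$ if and only if the Galois factorization of $T\cdot\$$ is $(G_1,G_2,\dots,G_k,\$)$.
   Context: Alternating order: for words $S,T$ with $S^\omega\neq T^\omega$ ($X^\omega$ the infinite repetition of $X$), let $j$ be the first position with $S^\omega[j]\neq T^\omega[j]$; $S\prec_{\mathrm{alt}}T$ if $j$ is odd and $S^\omega[j]<T^\omega[j]$, or $j$ is even and $S^\omega[j]>T^\omega[j]$. $S=_{\mathrm{alt}}T$ if $S^\omega=T^\omega$; $\succeq_{\mathrm{alt}}$ means $\succ_{\mathrm{alt}}$ or $=_{\mathrm{alt}}$. A word is Galois if it is strictly smaller with respect to $\prec_{\mathrm{alt}}$ than all its other cyclic rotations. The Galois factorization of a word $T$ is the unique sequence $(G_1,\dots,G_k)$ of Galois words with $T=G_1G_2\cdots G_k$ and $G_1\succeq_{\mathrm{alt}}G_2\succeq_{\mathrm{alt}}\cdots\succeq_{\mathrm{alt}}G_k$. -}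

module Defs where

open import Data.Nat using (ℕ; zero; suc; _<_)
open import Data.Nat.DivMod using (_mod_)
open import Data.List using (List; []; _∷_; _++_; length; lookup; take; drop; concat)
open import Data.List.Relation.Unary.All using (All)
open import Data.List.Relation.Unary.Linked using (Linked)
open import Data.Product using (Σ; _×_; ∃)
open import Data.Sum using (_⊎_)
open import Data.Empty using (⊥)
open import Relation.Binary.PropositionalEquality using (_≡_)

module Alt {A : Set} (_<ₐ_ : A → A → Set) where

  -- (a ∷ as)^ω as a function of 0-indexed positions.
  ω : A → List A → ℕ → A
  ω a as i = lookup (a ∷ as) (i mod (suc (length as)))

  -- Comparison at 0-indexed position j: 0-indexed even j is 1-indexed odd
  -- (require x < y); 0-indexed odd j is 1-indexed even (require x > y).
  altCmp : ℕ → A → A → Set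
  altCmp zero x y = x <ₐ y
  altCmp (suc zero) x y = y <ₐ x
  altCmp (suc (suc j)) x y = altCmp j x y

  -- S ≺alt T  (only defined for nonempty words; ⊥ otherwise)
  _≺alt_ : List A → List A → Set
  (a ∷ as) ≺alt (b ∷ bs) =
    ∃ λ j → (∀ i → i < j → ω a as i ≡ ω b bs i) × altCmp j (ω a as j) (ω b bs j)
  _ ≺alt _ = ⊥

  _=alt_ : List A → List A → Set
  (a ∷ as) =alt (b ∷ bs) = ∀ i → ω a as i ≡ ω b bs i
  _ =alt _ = ⊥

  _⪰alt_ : List A → List A → Set
  S ⪰alt T = (T ≺alt S) ⊎ (S =alt T)

  rot : ℕ → List A → List A
  rot k w = drop k w ++ take k w

  Galois : List A → Set
  Galois [] = ⊥
  Galois w@(_ ∷ _) = ∀ k → 0 < k → k < length w → w ≺alt rot k w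

  IsGaloisFactorization : List A → List (List A) → Set
  IsGaloisFactorization T Gs =
    (concat Gs ≡ T) × All Galois Gs × Linked _⪰alt_ Gs

{-# OPTIONS --safe #-}
module Submission where

-- [$] is a Galois word, and every factor G of T starts with a letter greater than $, so
-- the alternating comparison of G^ω with $^ω is decided at the first position: G ≻alt [$].
-- Hence appending [$] keeps the factors non-increasing; the converse only drops the last
-- factor and the last letter.

open import Defs
open import Data.Nat using (zero; suc; s≤s)
open import Data.List using (List; []; _∷_; _++_; _∷ʳ_; [_]; concat)
open import Data.List.Properties using (concat-++; ++-identityʳ; ∷ʳ-injectiveˡ)
open import Data.List.Relation.Unary.All as All using (All; []; _∷_)
open import Data.List.Relation.Unary.All.Properties using (concat⁻; ∷ʳ⁺; ∷ʳ⁻)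
open import Data.List.Relation.Unary.Linked using (Linked; []; [-]; _∷_)
open import Data.Product using (_×_; _,_; proj₁; uncurry)
open import Data.Sum using (inj₁)
open import Relation.Binary.PropositionalEquality using (_≡_; refl; sym; trans; cong; module ≡-Reasoning)
open import Relation.Binary.Structures using (IsStrictTotalOrder)

module _ {A : Set} {R : A → A → Set} where

  Linked-∷ʳ⁺ : ∀ {xs y} → Linked R xs → All (λ x → R x y) xs → Linked R (xs ∷ʳ y)
  Linked-∷ʳ⁺ []        []         = [-]
  Linked-∷ʳ⁺ [-]       (Rxy ∷ []) = Rxy ∷ [-]
  Linked-∷ʳ⁺ (Rxz ∷ l) (_ ∷ Rys)  = Rxz ∷ Linked-∷ʳ⁺ l Rys

  Linked-∷ʳ⁻ : ∀ xs {y} → Linked R (xs ∷ʳ y) → Linked R xs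
  Linked-∷ʳ⁻ []           _         = []
  Linked-∷ʳ⁻ (_ ∷ [])     _         = [-]
  Linked-∷ʳ⁻ (_ ∷ x ∷ xs) (Rxz ∷ l) = Rxz ∷ Linked-∷ʳ⁻ (x ∷ xs) l

concat-∷ʳ : {A : Set} (xss : List (List A)) (ys : List A) → concat (xss ∷ʳ ys) ≡ concat xss ++ ys
concat-∷ʳ xss ys = begin
  concat (xss ∷ʳ ys)          ≡⟨ sym (concat-++ xss [ ys ]) ⟩
  concat xss ++ (ys ++ [])    ≡⟨ cong (concat xss ++_) (++-identityʳ ys) ⟩
  concat xss ++ ys            ∎
  where open ≡-Reasoning

module _ {A : Set} (_<_ : A → A → Set) where
  open Alt _<_

  Galois-[_] : ∀ a → Galois [ a ]
  Galois-[ a ] zero    () _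
  Galois-[ a ] (suc k) _  (s≤s ())

  head-<⇒≺alt : ∀ {a b as bs} → a < b → (a ∷ as) ≺alt (b ∷ bs)
  head-<⇒≺alt a<b = 0 , (λ _ ()) , a<b

  ⪰alt-[_] : ∀ d {G} → Galois G → All (d <_) G → G ⪰alt [ d ]
  ⪰alt-[ d ] {_ ∷ _} _ (d<g ∷ _) = inj₁ (head-<⇒≺alt d<g)

  IsGaloisFactorization-∷ʳ⁺ : ∀ {T Gs d} → All (d <_) T →
    IsGaloisFactorization T Gs → IsGaloisFactorization (T ∷ʳ d) (Gs ∷ʳ [ d ])
  IsGaloisFactorization-∷ʳ⁺ {Gs = Gs} {d} d<T (refl , galois , linked) =
    concat-∷ʳ Gs [ d ] ,
    ∷ʳ⁺ galois Galois-[ d ] ,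
    Linked-∷ʳ⁺ linked (All.zipWith (uncurry ⪰alt-[ d ]) (galois , concat⁻ d<T))

  IsGaloisFactorization-∷ʳ⁻ : ∀ {T Gs d} →
    IsGaloisFactorization (T ∷ʳ d) (Gs ∷ʳ [ d ]) → IsGaloisFactorization T Gs
  IsGaloisFactorization-∷ʳ⁻ {T} {Gs} {d} (concat≡ , galois , linked) =
    ∷ʳ-injectiveˡ (concat Gs) T (trans (sym (concat-∷ʳ Gs [ d ])) concat≡) ,
    proj₁ (∷ʳ⁻ galois) ,
    Linked-∷ʳ⁻ Gs linked

lemma31 : {A : Set} (_<_ : A → A → Set) → IsStrictTotalOrder _≡_ _<_ →
    (T : List A) (dollar : A) → All (λ c → dollar < c) T →
    (Gs : List (List A)) →
    (Alt.IsGaloisFactorization _<_ T Gs →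
      Alt.IsGaloisFactorization _<_ (T ++ (dollar ∷ [])) (Gs ++ ((dollar ∷ []) ∷ [])))
    × (Alt.IsGaloisFactorization _<_ (T ++ (dollar ∷ [])) (Gs ++ ((dollar ∷ []) ∷ [])) →
      Alt.IsGaloisFactorization _<_ T Gs)
lemma31 _<_ _ T dollar dollar<T Gs =
  IsGaloisFactorization-∷ʳ⁺ _<_ dollar<T , IsGaloisFactorization-∷ʳ⁻ _<_
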